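{- For a positive integer $m$ let $h(m)=2^{v_2(m)}3^{v_3(m)}$ and $S(m)=h(5m+1)$. If $m\neq k$ are positive integers with $S(m)=k$ and $S(k)=m$, then $\{m,k\}=\{1,6\}$.
   Context: $v_p(m)$ denotes the exponent of the prime $p$ in $m$; $h(m)$ is the largest divisor of $m$ whose only prime factors are $2$ and $3$. -}

module Defs where

open import Data.Nat using (ℕ; zero; suc; _+_; _*_; _^_)
open import Data.Nat.DivMod using (_/_; _%_)
open import Data.Nat.Divisibility using (_∣?_)
open import Relation.Nullary using (yes; no)

-- vAux fuel p m : number of times p (≥ 2) divides m, with fuel bounding recursion.
-- For m ≥ 1 and fuel ≥ m this equals the p-adic valuation v_p(m).
vAux : ℕ → (p : ℕ) → ℕ → ℕ
vAux zero p m = zero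
vAux (suc fuel) zero m = zero
vAux (suc fuel) (suc q) m with suc q ∣? m
... | yes _ = suc (vAux fuel (suc q) (m / suc q))
... | no  _ = zero

v : (p : ℕ) → ℕ → ℕ
v p m = vAux m p m

h : ℕ → ℕ
h m = 2 ^ v 2 m * 3 ^ v 3 m

S : ℕ → ℕ
S m = h (5 * m + 1)

-- If S m = k and S k = m then k ∣ 5m + 1 and m ∣ 5k + 1. These force m and k to be coprime,
-- so m k divides 5m + 5k + 1; this is impossible once m, k ≥ 11, and the finitely many pairs
-- with min(m, k) ≤ 10 are checked by evaluating S.
module Submission where

open import Defs
open import Data.Nat using (ℕ; NonZero; zero; suc; _+_; _*_; _^_; _≤_; _<_; _≤?_)
open import Data.Nat.Properties
open import Data.Nat.Divisibility
open import Data.Nat.DivMod using (_/_; m*[n/m]≡n)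
open import Data.Nat.GCD using (gcd)
open import Data.Nat.LCM using (lcm; lcm-least; gcd*lcm)
open import Data.Nat.Coprimality as Coprimality
  using (Coprime; coprime-divisor; coprime⇒gcd≡1; gcd≡1⇒coprime)
open import Data.Nat.Tactic.RingSolver using (solve-∀)
open import Data.Product as Product using (_×_; _,_)
open import Data.Sum as Sum using (_⊎_; inj₁; inj₂)
open import Data.Empty using (⊥-elim)
open import Relation.Binary.PropositionalEquality
  using (_≡_; refl; sym; subst; cong; module ≡-Reasoning)
open import Relation.Nullary using (¬_; yes; no)
open import Function using (_∘′_)

vAux-pow-∣ : ∀ fuel p n → p ^ vAux fuel p n ∣ n
vAux-pow-∣ zero    p       n = 1∣ n
vAux-pow-∣ (suc f) zero    n = 1∣ n
vAux-pow-∣ (suc f) (suc q) n with suc q ∣? n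
... | yes q+1∣n = subst (suc q ^ suc (vAux f (suc q) (n / suc q)) ∣_) (m*[n/m]≡n q+1∣n)
                    (*-monoʳ-∣ (suc q) (vAux-pow-∣ f (suc q) (n / suc q)))
... | no  _     = 1∣ n

coprime-*ˡ : ∀ {a b c} → Coprime a c → Coprime b c → Coprime (a * b) c
coprime-*ˡ a⊥c b⊥c (d∣ab , d∣c) = b⊥c (coprime-divisor d⊥a d∣ab , d∣c)
  where
  d⊥a : Coprime _ _
  d⊥a (e∣d , e∣a) = a⊥c (e∣a , ∣-trans e∣d d∣c)

coprime-^ˡ : ∀ {a c} e → Coprime a c → Coprime (a ^ e) c
coprime-^ˡ zero    _   (d∣1 , _) = ∣1⇒≡1 d∣1
coprime-^ˡ (suc e) a⊥c = coprime-*ˡ a⊥c (coprime-^ˡ e a⊥c)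

coprime-^ : ∀ {a b} i j → Coprime a b → Coprime (a ^ i) (b ^ j)
coprime-^ i j a⊥b =
  coprime-^ˡ i (Coprimality.sym (coprime-^ˡ j (Coprimality.sym a⊥b)))

coprime⇒*∣ : ∀ {a b c} → Coprime a b → a ∣ c → b ∣ c → a * b ∣ c
coprime⇒*∣ {a} {b} a⊥b a∣c b∣c = subst (_∣ _) lcm≡a*b (lcm-least a∣c b∣c)
  where
  lcm≡a*b : lcm a b ≡ a * b
  lcm≡a*b = begin
    lcm a b           ≡⟨ sym (*-identityˡ (lcm a b)) ⟩
    1 * lcm a b       ≡⟨ cong (_* lcm a b) (sym (coprime⇒gcd≡1 a⊥b)) ⟩
    gcd a b * lcm a b ≡⟨ gcd*lcm a b ⟩
    a * b             ∎
    where open ≡-Reasoning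

h∣ : ∀ n → h n ∣ n
h∣ n = coprime⇒*∣ (coprime-^ (v 2 n) (v 3 n) (gcd≡1⇒coprime refl))
         (vAux-pow-∣ n 2 n) (vAux-pow-∣ n 3 n)

∣*+1⇒coprime : ∀ {m k} a → m ∣ a * k + 1 → Coprime m k
∣*+1⇒coprime a m∣ak+1 (d∣m , d∣k) =
  ∣1⇒≡1 (∣m+n∣m⇒∣n (∣-trans d∣m m∣ak+1) (∣n⇒∣m*n a d∣k))

∣5k+1⇒∣1+5m+5k : ∀ {m} k → m ∣ 5 * k + 1 → m ∣ suc (5 * m + 5 * k)
∣5k+1⇒∣1+5m+5k {m} k m∣5k+1 =
  subst (m ∣_) (regroup m k) (∣m∣n⇒∣m+n (∣n⇒∣m*n 5 (∣-refl {m})) m∣5k+1)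
  where
  regroup : ∀ m k → 5 * m + (5 * k + 1) ≡ suc (5 * m + 5 * k)
  regroup = solve-∀

reciprocal-divisors⇒*∣ : ∀ {m k} → k ∣ 5 * m + 1 → m ∣ 5 * k + 1 →
                         m * k ∣ suc (5 * m + 5 * k)
reciprocal-divisors⇒*∣ {m} {k} k∣5m+1 m∣5k+1 =
  coprime⇒*∣ (∣*+1⇒coprime 5 m∣5k+1) (∣5k+1⇒∣1+5m+5k k m∣5k+1)
    (subst (k ∣_) (cong suc (+-comm (5 * k) (5 * m))) (∣5k+1⇒∣1+5m+5k m k∣5m+1))

1+5m+5k<m*k : ∀ {m k} → 11 ≤ m → 11 ≤ k → suc (5 * m + 5 * k) < m * k
1+5m+5k<m*k 11≤m 11≤k
  with a , refl ← m≤n⇒∃[o]m+o≡n 11≤m | b , refl ← m≤n⇒∃[o]m+o≡n 11≤k =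
  subst (2+5m+5k ≤_) (excess a b) (m≤m+n 2+5m+5k (9 + 6 * a + 6 * b + a * b))
  where
  2+5m+5k : ℕ
  2+5m+5k = suc (suc (5 * (11 + a) + 5 * (11 + b)))
  excess : ∀ x y → suc (suc (5 * (11 + x) + 5 * (11 + y))) + (9 + 6 * x + 6 * y + x * y)
                   ≡ (11 + x) * (11 + y)
  excess = solve-∀

Reciprocal : ℕ → ℕ → Set
Reciprocal m k = (m ≡ 1 × k ≡ 6) ⊎ (m ≡ 6 × k ≡ 1)

reciprocal-swap : ∀ {m k} → Reciprocal k m → Reciprocal m k
reciprocal-swap = Sum.swap ∘′ Sum.map Product.swap Product.swap

S-reciprocal-≤10 : ∀ m {k} → m ≤ 10 → S m ≡ k → S k ≡ m → Reciprocal m k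
S-reciprocal-≤10 0  _ refl ()
S-reciprocal-≤10 1  _ refl _ = inj₁ (refl , refl)
S-reciprocal-≤10 2  _ refl ()
S-reciprocal-≤10 3  _ refl ()
S-reciprocal-≤10 4  _ refl ()
S-reciprocal-≤10 5  _ refl ()
S-reciprocal-≤10 6  _ refl _ = inj₂ (refl , refl)
S-reciprocal-≤10 7  _ refl ()
S-reciprocal-≤10 8  _ refl ()
S-reciprocal-≤10 9  _ refl ()
S-reciprocal-≤10 10 _ refl ()
S-reciprocal-≤10 (suc (suc (suc (suc (suc (suc (suc (suc (suc (suc (suc n))))))))))) m≤10 =
  ⊥-elim (<⇒≱ (m≤m+n 11 n) m≤10)

lemma4p5 : (m k : ℕ) → NonZero m → NonZero k → ¬ (m ≡ k) →
    S m ≡ k → S k ≡ m →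
    (m ≡ 1 × k ≡ 6) ⊎ (m ≡ 6 × k ≡ 1)
lemma4p5 m k _ _ _ Sm≡k Sk≡m with m ≤? 10 | k ≤? 10
... | yes m≤10 | _        = S-reciprocal-≤10 m m≤10 Sm≡k Sk≡m
... | no _     | yes k≤10 = reciprocal-swap (S-reciprocal-≤10 k k≤10 Sk≡m Sm≡k)
... | no m≰10  | no k≰10  =
  ⊥-elim (<⇒≱ (1+5m+5k<m*k (≰⇒> m≰10) (≰⇒> k≰10)) (∣⇒≤ mk∣1+5m+5k))
  where
  mk∣1+5m+5k : m * k ∣ suc (5 * m + 5 * k)
  mk∣1+5m+5k = reciprocal-divisors⇒*∣ (subst (_∣ _) Sm≡k (h∣ (5 * m + 1)))
                                         (subst (_∣ _) Sk≡m (h∣ (5 * k + 1)))
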